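{- Every $3$-tournament is a CR tournament.
   Context: A tournament is a digraph with exactly one arc between each pair of distinct vertices; an $n$-tournament has $n$ vertices. For distinct vertices write $\theta_T(u,v)=1$ if $u\to v$, $-1$ otherwise. Skew-adjacency matrix $S_T$: entry $1$ if $v_i\to v_j$, $-1$ if $v_j\to v_i$, $0$ on the diagonal; $\det(T)=\det(S_T)$. For odd $k\ge1$, $\mathcal{D}_k$ is the set of tournaments all of whose induced subtournaments have determinant at most $k^2$; $\mathcal{D}_{ -1}=\emptyset$. A diamond is a 4-tournament consisting of a 3-cycle plus a vertex dominating all of it or dominated by all of it. Two vertices $u_1,u_2$ of $T$ are covertices and revertices if $|V(T)|=2$; if $|V(T)|\ge3$ they are covertices if $\theta_T(u_1,v)=\theta_T(u_2,v)$ for all other $v$, revertices if $\theta_T(u_1,v)=-\theta_T(u_2,v)$ for all other $v$; CR-associated if covertices or revertices. For $u\notin V(T)=\{w_1,\dots,w_n\}$ and $\sigma=(r_1,\dots,r_n)\in\{\pm1\}^n$, $T(u,\sigma)$ extends $T$ by $u$ with $u\to w_i$ iff $r_i=1$; $u$ is a CR vertex for $T$ with $\sigma$ if $u$ is CR-associated in $T(u,\sigma)$ with some vertex of $T$, otherwise a non-CR vertex. Let $T\in\mathcal{D}_k\setminus\mathcal{D}_{k-2}$ for some odd $k$. $T$ is a CR tournament if $T$ is a 1-tournament, a 2-tournament or a diamond, or else for every $u\notin V(T)$ and every $\sigma$ with $u$ a non-CR vertex for $T$ with $\sigma$, $T(u,\sigma)\notin\mathcal{D}_k$. -}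

module Defs where

open import Data.Nat using (ℕ; zero; suc; _*_; _+_; _≤_)
open import Data.Integer as ℤ using (ℤ; +_; -_)
open import Data.Fin using (Fin; zero; suc; toℕ; punchIn)
open import Data.Fin.Properties using (_≟_)
open import Data.Bool using (Bool; true; false; not; if_then_else_)
open import Data.Bool.Properties using (not-involutive)
open import Data.Product using (Σ; _×_; _,_; ∃)
open import Data.Sum using (_⊎_)
open import Data.Empty using (⊥)
open import Relation.Nullary using (¬_; yes; no)
open import Relation.Binary.PropositionalEquality using (_≡_; _≢_; refl; sym; cong)
open import Function.Definitions using (Injective)

record Tournament (n : ℕ) : Set where
  field
    arc  : Fin n → Fin n → Bool
    anti : ∀ u v → u ≢ v → arc v u ≡ not (arc u v)
open Tournament public

skew : ∀ {n} → Tournament n → Fin n → Fin n → ℤ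
skew T i j with i ≟ j
... | yes _ = + 0
... | no _  = if arc T i j then + 1 else - (+ 1)

sumFin : ∀ n → (Fin n → ℤ) → ℤ
sumFin zero    f = + 0
sumFin (suc n) f = f zero ℤ.+ sumFin n (λ i → f (suc i))

sign : ℕ → ℤ
sign zero          = + 1
sign (suc zero)    = - (+ 1)
sign (suc (suc m)) = sign m

det : ∀ n → (Fin n → Fin n → ℤ) → ℤ
det zero    M = + 1
det (suc n) M =
  sumFin (suc n) λ j → sign (toℕ j) ℤ.* (M zero j ℤ.* det n (λ r c → M (suc r) (punchIn j c)))

detT : ∀ {n} → Tournament n → ℤ
detT {n} T = det n (skew T)

-- T ∈ D_k with k = 2j+1: every induced subtournament (vertex set = image of an
-- injection f : Fin m → Fin n; its skew matrix is S_T restricted along f) has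
-- determinant at most k².
InD : ∀ {n} → ℕ → Tournament n → Set
InD {n} j T = ∀ m (f : Fin m → Fin n) → Injective _≡_ _≡_ f →
  det m (λ a b → skew T (f a) (f b)) ℤ.≤ + ((2 * j + 1) * (2 * j + 1))

-- T ∈ D_{k-2} where k = 2j+1 (D_{-1} = ∅).
InDprev : ∀ {n} → ℕ → Tournament n → Set
InDprev zero    T = ⊥
InDprev (suc j) T = InD j T

Covertices : ∀ {n} → Tournament n → Fin n → Fin n → Set
Covertices {n} T a b = a ≢ b ×
  (n ≡ 2 ⊎ (3 ≤ n × (∀ v → v ≢ a → v ≢ b → arc T a v ≡ arc T b v)))

Revertices : ∀ {n} → Tournament n → Fin n → Fin n → Set
Revertices {n} T a b = a ≢ b ×
  (n ≡ 2 ⊎ (3 ≤ n × (∀ v → v ≢ a → v ≢ b → arc T a v ≡ not (arc T b v))))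

CRAssociated : ∀ {n} → Tournament n → Fin n → Fin n → Set
CRAssociated T a b = Covertices T a b ⊎ Revertices T a b

-- T(u,σ): new vertex u is `zero`, old vertex w_i is `suc i`; u → w_i iff σ i = true.
extArc : ∀ {n} → Tournament n → (Fin n → Bool) → Fin (suc n) → Fin (suc n) → Bool
extArc T σ zero    zero    = false
extArc T σ zero    (suc i) = σ i
extArc T σ (suc i) zero    = not (σ i)
extArc T σ (suc i) (suc j) = arc T i j

extAnti : ∀ {n} (T : Tournament n) (σ : Fin n → Bool) u v → u ≢ v →
  extArc T σ v u ≡ not (extArc T σ u v)
extAnti T σ zero    zero    p = ⊥-elim' (p refl)
  where ⊥-elim' : ∀ {A : Set} → ⊥ → A
        ⊥-elim' ()
extAnti T σ zero    (suc i) p = refl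
extAnti T σ (suc i) zero    p = sym (not-involutive (σ i))
extAnti T σ (suc i) (suc j) p = anti T i j (λ e → p (cong suc e))

extend : ∀ {n} → Tournament n → (Fin n → Bool) → Tournament (suc n)
extend T σ = record { arc = extArc T σ ; anti = extAnti T σ }

NonCR : ∀ {n} → Tournament n → (Fin n → Bool) → Set
NonCR {n} T σ = ∀ (i : Fin n) → ¬ CRAssociated (extend T σ) zero (suc i)

Diamond : ∀ {n} → Tournament n → Set
Diamond {n} T = n ≡ 4 × Σ (Fin n) λ a → Σ (Fin n) λ b → Σ (Fin n) λ c → Σ (Fin n) λ d →
  (a ≢ b × a ≢ c × a ≢ d × b ≢ c × b ≢ d × c ≢ d) ×
  (arc T a b ≡ true × arc T b c ≡ true × arc T c a ≡ true) ×
  ((arc T d a ≡ true × arc T d b ≡ true × arc T d c ≡ true) ⊎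
   (arc T a d ≡ true × arc T b d ≡ true × arc T c d ≡ true))

CRTournament : ∀ {n} → Tournament n → Set
CRTournament {n} T = Σ ℕ λ j → InD j T × ¬ InDprev j T ×
  (n ≡ 1 ⊎ n ≡ 2 ⊎ Diamond T ⊎
   (∀ (σ : Fin n → Bool) → NonCR T σ → ¬ InD j (extend T σ)))

{-# OPTIONS --safe #-}
module Submission where

-- The skew matrix of a tournament is alternating with entries ±1 off the diagonal.
-- Alternating matrices of odd order have determinant 0 and those of order 2 have
-- determinant a², so every 3-tournament lies in D₁ (and D₋₁ = ∅).  Extending by u
-- gives a 4-tournament whose determinant is the square of its Pfaffian
-- θ(u,w₀)θ(w₁,w₂) − θ(u,w₁)θ(w₀,w₂) + θ(u,w₂)θ(w₀,w₁), one ±1 term per perfect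
-- matching, determined by the parity (xor) of the matching's two arcs.  If u is not
-- CR-associated with w₁, the matchings {uw₀, w₁w₂} and {uw₂, w₀w₁} have equal parity;
-- if it is not CR-associated with w₂, {uw₀, w₁w₂} and {uw₁, w₀w₂} have opposite
-- parity.  Then the three terms coincide, the Pfaffian is ±3 and the determinant 9.

open import Defs
open import Data.Bool using (Bool; true; false; not; _xor_; if_then_else_)
open import Data.Bool.Properties
  using (not-involutive; ¬-not; xor-assoc; xor-same; xor-identityʳ; not-distribˡ-xor; not-distribʳ-xor)
open import Data.Fin using (Fin; zero; suc; toℕ; punchIn; #_; combine; remQuot)
open import Data.Fin.Properties using (_≟_; <-cmp; injective⇒≤; remQuot-combine)
open import Data.Integer using (ℤ; +_; -_; _+_; _-_; _*_; _≤_; +≤+)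
open import Data.Integer.Properties using (≤-refl; ≤-reflexive; ≤-trans)
open import Data.Integer.Solver using (module +-*-Solver)
open import Data.Nat as ℕ using (zero; suc; z≤n; s≤s)
import Data.Nat.Properties as ℕₚ
open import Data.Product using (_×_; _,_; uncurry)
open import Data.Sum using (_⊎_; inj₁; inj₂)
open import Data.Vec using (Vec; tabulate; lookup)
open import Data.Vec.Properties using (lookup∘tabulate)
open import Function using (_∘_; id)
open import Relation.Binary.Definitions using (tri<; tri≈; tri>)
open import Relation.Binary.PropositionalEquality
  using (_≡_; _≢_; refl; sym; trans; cong; cong₂; subst; module ≡-Reasoning)
open import Relation.Nullary using (¬_; yes; no; contradiction)

open +-*-Solver using (Polynomial; con; var; _:+_; _:*_; :-_; _:-_; ⟦_⟧; ⟦_⟧↓; prove)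

Alternating : ∀ {n} → (Fin n → Fin n → ℤ) → Set
Alternating M = (∀ a → M a a ≡ + 0) × (∀ a b → M b a ≡ - M a b)

sumFin-cong : ∀ n {f g : Fin n → ℤ} → (∀ i → f i ≡ g i) → sumFin n f ≡ sumFin n g
sumFin-cong zero    f≡g = refl
sumFin-cong (suc n) f≡g = cong₂ _+_ (f≡g zero) (sumFin-cong n (f≡g ∘ suc))

det-cong : ∀ n {M N : Fin n → Fin n → ℤ} → (∀ a b → M a b ≡ N a b) → det n M ≡ det n N
det-cong zero    M≡N = refl
det-cong (suc n) M≡N = sumFin-cong (suc n) λ j →
  cong₂ (λ x d → sign (toℕ j) * (x * d)) (M≡N zero j) (det-cong n λ r c → M≡N (suc r) (punchIn j c))

minor : ∀ {n} {A : Set} → (Fin (suc n) → Fin (suc n) → A) → Fin (suc n) → Fin n → Fin n → A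
minor M j r c = M (suc r) (punchIn j c)

sumₚ : ∀ n {m} → (Fin n → Polynomial m) → Polynomial m
sumₚ zero    f = con (+ 0)
sumₚ (suc n) f = f zero :+ sumₚ n (f ∘ suc)

-- The determinant as a solver polynomial, so that determinant identities in a fixed
-- small order are decided by normalisation (prove).
detₚ : ∀ n {m} → (Fin n → Fin n → Polynomial m) → Polynomial m
detₚ zero    X = con (+ 1)
detₚ (suc n) X = sumₚ (suc n) λ j → con (sign (toℕ j)) :* (X zero j :* detₚ n (minor X j))

⟦sumₚ⟧ : ∀ n {m} (f : Fin n → Polynomial m) ρ → ⟦ sumₚ n f ⟧ ρ ≡ sumFin n (λ j → ⟦ f j ⟧ ρ)
⟦sumₚ⟧ zero    f ρ = refl
⟦sumₚ⟧ (suc n) f ρ = cong (λ s → ⟦ f zero ⟧ ρ + s) (⟦sumₚ⟧ n (f ∘ suc) ρ)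

⟦detₚ⟧ : ∀ n {m} (X : Fin n → Fin n → Polynomial m) ρ → ⟦ detₚ n X ⟧ ρ ≡ det n (λ a b → ⟦ X a b ⟧ ρ)
⟦detₚ⟧ zero    X ρ = refl
⟦detₚ⟧ (suc n) X ρ = trans (⟦sumₚ⟧ (suc n) cofactor ρ) (sumFin-cong (suc n) λ j →
  cong (λ d → sign (toℕ j) * (⟦ X zero j ⟧ ρ * d)) (⟦detₚ⟧ n (minor X j) ρ))
  where cofactor = λ j → con (sign (toℕ j)) :* (X zero j :* detₚ n (minor X j))

-- The variable combine a b stands for the entry (a , b); only those with a < b occur.
alternatingₚ : ∀ n → Fin n → Fin n → Polynomial (n ℕ.* n)
alternatingₚ n a b with <-cmp a b
... | tri< _ _ _ = var (combine a b)
... | tri≈ _ _ _ = con (+ 0)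
... | tri> _ _ _ = :- var (combine b a)

entries : ∀ {n} → (Fin n → Fin n → ℤ) → Vec ℤ (n ℕ.* n)
entries {n} M = tabulate (uncurry M ∘ remQuot n)

lookup-entries : ∀ {n} (M : Fin n → Fin n → ℤ) a b → lookup (entries M) (combine a b) ≡ M a b
lookup-entries {n} M a b =
  trans (lookup∘tabulate (uncurry M ∘ remQuot n) (combine a b)) (cong (uncurry M) (remQuot-combine a b))

⟦alternatingₚ⟧ : ∀ {n} {M : Fin n → Fin n → ℤ} → Alternating M →
  ∀ a b → ⟦ alternatingₚ n a b ⟧ (entries M) ≡ M a b
⟦alternatingₚ⟧ {M = M} (diagonal , antisymmetric) a b with <-cmp a b
... | tri< _ _ _    = lookup-entries M a b
... | tri≈ _ refl _ = sym (diagonal a)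
... | tri> _ _ _    = trans (cong -_ (lookup-entries M b a)) (sym (antisymmetric b a))

det-alternating : ∀ n {M : Fin n → Fin n → ℤ} → Alternating M →
  det n M ≡ ⟦ detₚ n (alternatingₚ n) ⟧ (entries M)
det-alternating n alt = trans (det-cong n λ a b → sym (⟦alternatingₚ⟧ alt a b)) (sym (⟦detₚ⟧ n _ _))

det-alternating-by-normalisation : ∀ n {M : Fin n → Fin n → ℤ} → Alternating M → (q : Polynomial (n ℕ.* n)) →
  ⟦ detₚ n (alternatingₚ n) ⟧↓ (entries M) ≡ ⟦ q ⟧↓ (entries M) → det n M ≡ ⟦ q ⟧ (entries M)
det-alternating-by-normalisation n {M} alt q eq =
  trans (det-alternating n alt) (prove (entries M) (detₚ n (alternatingₚ n)) q eq)

det₁-alternating : ∀ {M} → Alternating M → det 1 M ≡ + 0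
det₁-alternating alt = det-alternating-by-normalisation 1 alt (con (+ 0)) refl

det₂-alternating : ∀ {M} → Alternating M → det 2 M ≡ M (# 0) (# 1) * M (# 0) (# 1)
det₂-alternating alt = det-alternating-by-normalisation 2 alt (X (# 0) (# 1) :* X (# 0) (# 1)) refl
  where X = alternatingₚ 2

det₃-alternating : ∀ {M} → Alternating M → det 3 M ≡ + 0
det₃-alternating alt = det-alternating-by-normalisation 3 alt (con (+ 0)) refl

pfaffian₄ : (Fin 4 → Fin 4 → ℤ) → ℤ
pfaffian₄ M = M (# 0) (# 1) * M (# 2) (# 3) - M (# 0) (# 2) * M (# 1) (# 3) + M (# 0) (# 3) * M (# 1) (# 2)

det₄-alternating : ∀ {M} → Alternating M → det 4 M ≡ pfaffian₄ M * pfaffian₄ M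
det₄-alternating alt = det-alternating-by-normalisation 4 alt (pfₚ :* pfₚ) refl
  where
  X = alternatingₚ 4
  pfₚ = X (# 0) (# 1) :* X (# 2) (# 3) :- X (# 0) (# 2) :* X (# 1) (# 3) :+ X (# 0) (# 3) :* X (# 1) (# 2)

det-alternating≤1 : ∀ m (M : Fin m → Fin m → ℤ) → m ℕ.≤ 3 → Alternating M →
  (∀ a b → M a b * M a b ≤ + 1) → det m M ≤ + 1
det-alternating≤1 0 M _ _   _      = ≤-refl
det-alternating≤1 1 M _ alt _      = ≤-trans (≤-reflexive (det₁-alternating alt)) (+≤+ z≤n)
det-alternating≤1 2 M _ alt square = ≤-trans (≤-reflexive (det₂-alternating alt)) (square (# 0) (# 1))
det-alternating≤1 3 M _ alt _      = ≤-trans (≤-reflexive (det₃-alternating alt)) (+≤+ z≤n)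
det-alternating≤1 (suc (suc (suc (suc _)))) M (s≤s (s≤s (s≤s ()))) _ _

sgn : Bool → ℤ
sgn b = if b then + 1 else - (+ 1)

sgn-not : ∀ p → sgn (not p) ≡ - sgn p
sgn-not false = refl
sgn-not true  = refl

sgn²≡1 : ∀ p → sgn p * sgn p ≡ + 1
sgn²≡1 false = refl
sgn²≡1 true  = refl

sgn-* : ∀ p q → sgn p * sgn q ≡ - sgn (p xor q)
sgn-* false false = refl
sgn-* false true  = refl
sgn-* true  false = refl
sgn-* true  true  = refl

module _ {n} (T : Tournament n) where

  skew-diagonal : ∀ u → skew T u u ≡ + 0
  skew-diagonal u with u ≟ u
  ... | yes _   = refl
  ... | no u≢u = contradiction refl u≢u

  skew-antisymmetric : ∀ u v → skew T v u ≡ - skew T u v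
  skew-antisymmetric u v with u ≟ v | v ≟ u
  ... | yes _   | yes _   = refl
  ... | yes u≡v | no v≢u = contradiction (sym u≡v) v≢u
  ... | no u≢v | yes v≡u = contradiction (sym v≡u) u≢v
  ... | no u≢v | no _    = trans (cong sgn (anti T u v u≢v)) (sgn-not (arc T u v))

  skew²≤1 : ∀ u v → skew T u v * skew T u v ≤ + 1
  skew²≤1 u v with u ≟ v
  ... | yes _ = +≤+ z≤n
  ... | no _  = ≤-reflexive (sgn²≡1 (arc T u v))

  skew-alternating : ∀ {m} (f : Fin m → Fin n) → Alternating (λ a b → skew T (f a) (f b))
  skew-alternating f = (λ a → skew-diagonal (f a)) , (λ a b → skew-antisymmetric (f a) (f b))

  detT≡9⇒∉D₁ : detT T ≡ + 9 → ¬ InD 0 T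
  detT≡9⇒∉D₁ detT≡9 T∈D₁ with subst (_≤ + 1) detT≡9 (T∈D₁ n id id)
  ... | +≤+ (s≤s ())

tournament≤3∈D₁ : ∀ {n} → n ℕ.≤ 3 → (T : Tournament n) → InD 0 T
tournament≤3∈D₁ n≤3 T m f f-injective =
  det-alternating≤1 m _ (ℕₚ.≤-trans (injective⇒≤ f-injective) n≤3)
    (skew-alternating T f) (λ a b → skew²≤1 T (f a) (f b))

xor-solveˡ : ∀ p q {s} → p xor q ≡ s → p ≡ s xor q
xor-solveˡ p q refl = sym (trans (xor-assoc p q q) (trans (cong (p xor_) (xor-same q)) (xor-identityʳ p)))

xor-interchange : ∀ a b c d → a xor b ≡ c xor d → a xor d ≡ c xor b
xor-interchange false b false d b≡d  = sym b≡d
xor-interchange true  b true  d b≡d  = sym b≡d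
xor-interchange false b true  d b≡¬d = sym (trans (cong not b≡¬d) (not-involutive d))
xor-interchange true  b false d ¬b≡d = trans (cong not (sym ¬b≡d)) (not-involutive b)

module _ {n} (T : Tournament n) {a b : Fin n} (3≤n : 3 ℕ.≤ n) (a≢b : a ≢ b) where

  CR-of-constant-split : ∀ s → (∀ v → v ≢ a → v ≢ b → arc T a v ≡ s xor arc T b v) → CRAssociated T a b
  CR-of-constant-split false same     = inj₁ (a≢b , inj₂ (3≤n , same))
  CR-of-constant-split true  opposite = inj₂ (a≢b , inj₂ (3≤n , opposite))

  CR-of-split : ∀ {c d} → (∀ v → v ≢ a → v ≢ b → v ≡ c ⊎ v ≡ d) →
    arc T a c xor arc T b c ≡ arc T a d xor arc T b d → CRAssociated T a b
  CR-of-split {c} {d} cover split≡ = CR-of-constant-split (arc T a c xor arc T b c) constant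
    where
    constant : ∀ v → v ≢ a → v ≢ b → arc T a v ≡ (arc T a c xor arc T b c) xor arc T b v
    constant v v≢a v≢b with cover v v≢a v≢b
    ... | inj₁ refl = xor-solveˡ (arc T a c) (arc T b c) refl
    ... | inj₂ refl = xor-solveˡ (arc T a d) (arc T b d) (sym split≡)

pfaffian²-of-parities : ∀ p q r → q ≡ not p → r ≡ p →
  (- sgn p - - sgn q + - sgn r) * (- sgn p - - sgn q + - sgn r) ≡ + 9
pfaffian²-of-parities false .true  .false refl refl = refl
pfaffian²-of-parities true  .false .true  refl refl = refl

module _ (E : Tournament 4) where
  open ≡-Reasoning

  private
    a₀₁ = arc E (# 0) (# 1)
    a₀₂ = arc E (# 0) (# 2)
    a₀₃ = arc E (# 0) (# 3)
    a₁₂ = arc E (# 1) (# 2)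
    a₁₃ = arc E (# 1) (# 3)
    a₂₃ = arc E (# 2) (# 3)
    π₁ = a₀₁ xor a₂₃
    π₂ = a₀₂ xor a₁₃
    π₃ = a₀₃ xor a₁₂

  pfaffian₄-skew : pfaffian₄ (skew E) ≡ - sgn π₁ - - sgn π₂ + - sgn π₃
  pfaffian₄-skew = cong₂ _+_ (cong₂ _-_ (sgn-* a₀₁ a₂₃) (sgn-* a₀₂ a₁₃)) (sgn-* a₀₃ a₁₂)

  private
    CR₀₂ : π₃ ≡ not π₁ → CRAssociated E (# 0) (# 2)
  CR₀₂ π₃≡¬π₁ = CR-of-split E (ℕₚ.n≤1+n 3) (λ ()) cover (begin
    a₀₁ xor arc E (# 2) (# 1)  ≡⟨ cong (a₀₁ xor_) (anti E (# 1) (# 2) (λ ())) ⟩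
    a₀₁ xor not a₁₂            ≡⟨ not-distribʳ-xor a₀₁ a₁₂ ⟨
    not (a₀₁ xor a₁₂)          ≡⟨ not-distribˡ-xor a₀₁ a₁₂ ⟩
    not a₀₁ xor a₁₂            ≡⟨ xor-interchange a₀₃ a₁₂ (not a₀₁) a₂₃ (trans π₃≡¬π₁ (not-distribˡ-xor a₀₁ a₂₃)) ⟨
    a₀₃ xor a₂₃                ∎)
    where
    cover : ∀ v → v ≢ # 0 → v ≢ # 2 → v ≡ # 1 ⊎ v ≡ # 3
    cover zero                   v≢0 _   = contradiction refl v≢0
    cover (suc zero)             _   _   = inj₁ refl
    cover (suc (suc zero))       _   v≢2 = contradiction refl v≢2
    cover (suc (suc (suc zero))) _   _   = inj₂ refl

  CR₀₃ : π₁ ≡ π₂ → CRAssociated E (# 0) (# 3)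
  CR₀₃ π₁≡π₂ = CR-of-split E (ℕₚ.n≤1+n 3) (λ ()) cover (begin
    a₀₁ xor arc E (# 3) (# 1)  ≡⟨ cong (a₀₁ xor_) (anti E (# 1) (# 3) (λ ())) ⟩
    a₀₁ xor not a₁₃            ≡⟨ not-distribʳ-xor a₀₁ a₁₃ ⟨
    not (a₀₁ xor a₁₃)          ≡⟨ cong not (xor-interchange a₀₁ a₂₃ a₀₂ a₁₃ π₁≡π₂) ⟩
    not (a₀₂ xor a₂₃)          ≡⟨ not-distribʳ-xor a₀₂ a₂₃ ⟩
    a₀₂ xor not a₂₃            ≡⟨ cong (a₀₂ xor_) (anti E (# 2) (# 3) (λ ())) ⟨
    a₀₂ xor arc E (# 3) (# 2)  ∎)
    where
    cover : ∀ v → v ≢ # 0 → v ≢ # 3 → v ≡ # 1 ⊎ v ≡ # 2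
    cover zero                   v≢0 _   = contradiction refl v≢0
    cover (suc zero)             _   _   = inj₁ refl
    cover (suc (suc zero))       _   _   = inj₂ refl
    cover (suc (suc (suc zero))) _   v≢3 = contradiction refl v≢3

  non-CR⇒detT≡9 : ¬ CRAssociated E (# 0) (# 2) → ¬ CRAssociated E (# 0) (# 3) → detT E ≡ + 9
  non-CR⇒detT≡9 ¬CR₀₂ ¬CR₀₃ = begin
    detT E                                                ≡⟨ det₄-alternating (skew-alternating E id) ⟩
    pfaffian₄ (skew E) * pfaffian₄ (skew E)               ≡⟨ cong (λ x → x * x) pfaffian₄-skew ⟩
    (- sgn π₁ - - sgn π₂ + - sgn π₃) * (- sgn π₁ - - sgn π₂ + - sgn π₃)
      ≡⟨ pfaffian²-of-parities π₁ π₂ π₃ π₂≡¬π₁ π₃≡π₁ ⟩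
    + 9                                                   ∎
    where
    π₂≡¬π₁ : π₂ ≡ not π₁
    π₂≡¬π₁ = ¬-not λ π₂≡π₁ → ¬CR₀₃ (CR₀₃ (sym π₂≡π₁))
    π₃≡π₁ : π₃ ≡ π₁
    π₃≡π₁ = trans (¬-not (¬CR₀₂ ∘ CR₀₂)) (not-involutive π₁)

proposition2p7 : (T : Tournament 3) → CRTournament T
proposition2p7 T = 0 , tournament≤3∈D₁ ℕₚ.≤-refl T , (λ ()) , inj₂ (inj₂ (inj₂ λ σ non-CR →
  detT≡9⇒∉D₁ (extend T σ) (non-CR⇒detT≡9 (extend T σ) (non-CR (# 1)) (non-CR (# 2)))))
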